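{- Let $J\subseteq I\subseteq\mathbb{N}$ with $0\in I\setminus J$, let $X$ be an oracle, and let $c:[\mathbb{N}]^2\to\mathbb{N}$ satisfy in $X$ every requirement with range $I$ which is transitive in every color in $J$. Then for every infinite set $B$ which is $X$-computable (or even $X$-computably enumerable), $\{c(a,b): a<b,\ a,b\in B\}\supseteq I$.
   Context: For $c:[\mathbb{N}]^2\to\mathbb{N}$ (written $c(a,b)$, $a<b$) and $i\in\mathbb{N}$, $A^*_i(c)$ is the set of $n$ such that $c(n,m)=i$ for all but finitely many $m$. A requirement $R=(T,\{K_\sigma\}_{\sigma\in T},\{d_\sigma\}_{\sigma\in T})$ consists of a finite tree $T$ of finite sequences of natural numbers (closed under initial segments); for each $\sigma\in T$ an oracle Turing functional $K_\sigma$, so that for each oracle $X$, $K^X_\sigma(\bar b,\vec a)$ is an $X$-computable relation between finite sequences $\bar b$ of naturals and finite tuples $\vec a$ of naturals, with $K_{\langle\rangle}$ always true; and for each $\sigma\in T$ a function $d_\sigma:\{0,\dots,|\sigma|-1\}\to\mathbb{N}$. For $\sigma\in T$, $\Delta^X_{R;\sigma}(b_0,\dots,b_{|\sigma|-1},\vec a_0,\dots,\vec a_{|\sigma|-1})$ holds iff $K^X_{\sigma\upharpoonright(i+1)}((b_0,\dots,b_i),\vec a_i)$ holds for every $i<|\sigma|$. If $\sigma$ is a leaf, $\Theta^X_{R;\sigma}(c)$ holds iff there are $b_i,\vec a_i$ ($i<|\sigma|$) with all entries of $\vec a_i$ in $A^*_{d_\sigma(i)}(c)$ and $\Delta^X_{R;\sigma}$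 holding. If $\sigma$ is not a leaf, $\Theta^X_{R;\sigma}(c)$ holds iff there are such $b_i,\vec a_i$ and a number $t$ such that there do not exist $b$, a tuple $\vec a$ with all entries $>t$, and an immediate extension $\tau$ of $\sigma$ in $T$ with $\Delta^X_{R;\tau}(b_0,\dots,b_{|\sigma|-1},b,\vec a_0,\dots,\vec a_{|\sigma|-1},\vec a)$. $c$ satisfies $R$ in $X$ if $\Theta^X_{R;\sigma}(c)$ holds for some $\sigma\in T$. $R$ has range $I$ if $\mathrm{rng}(d_\sigma)\subseteq I$ for all $\sigma$. $R$ is transitive in color $i$ if whenever $\tau$ is a proper initial segment of $\sigma$ in $T$, $j<|\tau|$, $d_\tau(j)=i$ and $d_\sigma(|\tau|)=i$, then $d_\sigma(j)=i$. -}

module Defs where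

open import Data.Nat using (ℕ; zero; suc; _+_; _*_; _∸_; _^_; _≤_; _<_)
open import Data.Bool using (Bool; true; false; if_then_else_)
open import Data.Fin using (Fin)
open import Data.Vec using (Vec; []; _∷_; lookup)
open import Data.List using (List; []; _∷_; _++_; [_]; length; take; map; upTo)
open import Data.List.Membership.Propositional using (_∈_)
open import Data.List.Relation.Unary.All using (All)
open import Data.Product using (Σ; ∃; _×_; _,_)
open import Data.Sum using (_⊎_)
open import Relation.Nullary using (¬_)
open import Relation.Binary.PropositionalEquality using (_≡_)

Oracle : Set
Oracle = ℕ → Bool

data Code : ℕ → Set where
  czero : ∀ {n} → Code n
  csucc : Code 1
  cproj : ∀ {n} → Fin n → Code n
  ccomp : ∀ {n m} → Code m → Vec (Code n) m → Code n
  crec  : ∀ {n} → Code n → Code (suc (suc n)) → Code (suc n)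
  cmu   : ∀ {n} → Code (suc n) → Code n
  corac : Code 1

-- Big-step evaluation: Eval X e xs v  means  Φ_e^X(xs) ↓ = v.
mutual
  data Eval (X : Oracle) : ∀ {n} → Code n → Vec ℕ n → ℕ → Set where
    ev-zero : ∀ {n} {xs : Vec ℕ n} → Eval X czero xs 0
    ev-succ : ∀ {x} → Eval X csucc (x ∷ []) (suc x)
    ev-proj : ∀ {n} {i : Fin n} {xs} → Eval X (cproj i) xs (lookup xs i)
    ev-comp : ∀ {n m} {f : Code m} {gs : Vec (Code n) m} {xs ys v} →
              EvalV X gs xs ys → Eval X f ys v → Eval X (ccomp f gs) xs v
    ev-rec0 : ∀ {n} {f : Code n} {g xs v} →
              Eval X f xs v → Eval X (crec f g) (0 ∷ xs) v
    ev-recS : ∀ {n} {f : Code n} {g xs k r v} →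
              Eval X (crec f g) (k ∷ xs) r → Eval X g (k ∷ r ∷ xs) v →
              Eval X (crec f g) (suc k ∷ xs) v
    ev-mu   : ∀ {n} {f : Code (suc n)} {xs y} →
              Eval X f (y ∷ xs) 0 →
              ((z : ℕ) → z < y → Σ ℕ λ w → Eval X f (z ∷ xs) (suc w)) →
              Eval X (cmu f) xs y
    ev-orac : ∀ {x} → Eval X corac (x ∷ []) (if X x then 1 else 0)

  data EvalV (X : Oracle) : ∀ {n m} → Vec (Code n) m → Vec ℕ n → Vec ℕ m → Set where
    evv-nil  : ∀ {n} {xs : Vec ℕ n} → EvalV X [] xs []
    evv-cons : ∀ {n m} {g : Code n} {gs : Vec (Code n) m} {xs y ys} →
               Eval X g xs y → EvalV X gs xs ys → EvalV X (g ∷ gs) xs (y ∷ ys)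

-- B is X-computably enumerable: B is the domain of some Φ_e^X.
XCE : Oracle → (ℕ → Set) → Set
XCE X B = Σ (Code 1) λ e → ∀ n → (B n → ∃ λ v → Eval X e (n ∷ []) v)
                              × ((∃ λ v → Eval X e (n ∷ []) v) → B n)

Infinite : (ℕ → Set) → Set
Infinite B = ∀ n → ∃ λ m → n < m × B m

pair : ℕ → ℕ → ℕ
pair x y = 2 ^ x * (2 * y + 1) ∸ 1

enc : List ℕ → ℕ
enc []       = 0
enc (x ∷ xs) = suc (pair x (enc xs))

-- Colorings c : [ℕ]² → ℕ, represented by c : ℕ → ℕ → ℕ where only the
-- values c a b with a < b are meaningful.

Coloring : Set
Coloring = ℕ → ℕ → ℕ

AStar : Coloring → ℕ → ℕ → Set
AStar c i n = ∃ λ t → ∀ m → t < m → c n m ≡ i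

_⊑_ : List ℕ → List ℕ → Set
τ ⊑ σ = ∃ λ ρ → τ ++ ρ ≡ σ

record Requirement : Set where
  field
    T       : List (List ℕ)
    root    : [] ∈ T
    closed  : ∀ {σ τ} → σ ∈ T → τ ⊑ σ → τ ∈ T
    K       : List ℕ → Code 2                      -- K_σ(b̄, a⃗) via Φ^X(enc b̄, enc a⃗)
    Ktotal  : ∀ σ → σ ∈ T → ∀ (X : Oracle) x y → ∃ λ v → Eval X (K σ) (x ∷ y ∷ []) v
    Kroot   : ∀ (X : Oracle) x y → ∃ λ v → Eval X (K []) (x ∷ y ∷ []) (suc v)
    d       : List ℕ → ℕ → ℕ                       -- d_σ(i), meaningful for i < |σ|

module _ (R : Requirement) where
  open Requirement R

  KHolds : Oracle → List ℕ → List ℕ → List ℕ → Set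
  KHolds X σ bs as = ∃ λ v → Eval X (K σ) (enc bs ∷ enc as ∷ []) (suc v)

  Δ : Oracle → List ℕ → (ℕ → ℕ) → (ℕ → List ℕ) → Set
  Δ X σ b a = ∀ i → i < length σ →
              KHolds X (take (suc i) σ) (map b (upTo (suc i))) (a i)

  IsLeaf : List ℕ → Set
  IsLeaf σ = ∀ k → ¬ ((σ ++ [ k ]) ∈ T)

  ext : {A : Set} → (ℕ → A) → ℕ → A → (ℕ → A)
  ext f n x i with Data.Nat._<ᵇ_ i n
  ... | true  = f i
  ... | false = x

  Base : Oracle → Coloring → List ℕ → (ℕ → ℕ) → (ℕ → List ℕ) → Set
  Base X c σ b a = (∀ i → i < length σ → All (AStar c (d σ i)) (a i)) × Δ X σ b a

  Θ : Oracle → Coloring → List ℕ → Set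
  Θ X c σ =
      (IsLeaf σ × ∃ λ b → ∃ λ a → Base X c σ b a)
    ⊎ (¬ IsLeaf σ × ∃ λ b → ∃ λ a → Base X c σ b a × ∃ λ t →
         ¬ (∃ λ b' → ∃ λ a' → All (t <_) a' × ∃ λ k → ((σ ++ [ k ]) ∈ T) ×
             Δ X (σ ++ [ k ]) (ext b (length σ) b') (ext a (length σ) a')))

  Satisfies : Oracle → Coloring → Set
  Satisfies X c = ∃ λ σ → σ ∈ T × Θ X c σ

  HasRange : (ℕ → Set) → Set
  HasRange I = ∀ σ → σ ∈ T → ∀ i → i < length σ → I (d σ i)

  TransitiveIn : ℕ → Set
  TransitiveIn col = ∀ τ σ → τ ∈ T → σ ∈ T → τ ⊑ σ → length τ < length σ →
                     ∀ j → j < length τ → d τ j ≡ col → d σ (length τ) ≡ col →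
                     d σ j ≡ col

module Submission where

-- Let B = dom Φₑ^X be infinite and i ∈ I.  The requirement with tree {⟨⟩, ⟨0⟩} and constant colour i
-- whose functional at ⟨0⟩ accepts (⟨b⟩, ⟨n⟩) when Φₑ^X(n) converges by stage b has range {i} ⊆ I and
-- is transitive in every colour, so c satisfies it.  At the root this would say that no element of B
-- lies above some t, contradicting infiniteness; at the leaf it yields n ∈ B ∩ A*ᵢ(c), and then
-- c(n, m) = i for all large m ∈ B.  The work lies in making that functional total: it is a clocked
-- interpreter for oracle partial recursive codes.

open import Defs
open import Data.Nat
  using (ℕ; zero; suc; _+_; _*_; _∸_; _^_; _⊔_; _≤_; _<_; _≤′_; ≤′-refl; ≤′-step; pred; z≤n; s≤s)
open import Data.Nat.Properties
open import Data.Bool using (if_then_else_)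
open import Data.Fin using (Fin; _↑ʳ_) renaming (zero to fzero; suc to fsuc)
open import Data.Vec using (Vec; []; _∷_; lookup; map; tabulate; _++_)
open import Data.Vec.Properties
  using (∷-injectiveˡ; ∷-injectiveʳ; map-∘; map-id; lookup-++ʳ; tabulate-cong; tabulate∘lookup)
open import Data.List using (List; []; _∷_; [_])
open import Data.List.Membership.Propositional using (_∈_)
open import Data.List.Relation.Unary.All as All using (All; []; _∷_)
open import Data.List.Relation.Unary.Any using (here; there)
open import Data.Product using (∃; _×_; _,_; proj₁; proj₂)
open import Data.Sum using (_⊎_; inj₁; inj₂)
open import Data.Empty using (⊥-elim)
open import Relation.Nullary using (¬_; contradiction)
open import Relation.Binary using (tri<; tri≈; tri>)
open import Relation.Binary.PropositionalEquality
  using (_≡_; _≢_; refl; sym; trans; cong; cong₂; subst; module ≡-Reasoning)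

module _ {X : Oracle} where
  mutual
    Eval-deterministic : ∀ {n} {f : Code n} {xs v w} → Eval X f xs v → Eval X f xs w → v ≡ w
    Eval-deterministic ev-zero ev-zero = refl
    Eval-deterministic ev-succ ev-succ = refl
    Eval-deterministic ev-proj ev-proj = refl
    Eval-deterministic (ev-comp ds d) (ev-comp ds′ d′) with EvalV-deterministic ds ds′
    ... | refl = Eval-deterministic d d′
    Eval-deterministic (ev-rec0 d) (ev-rec0 d′) = Eval-deterministic d d′
    Eval-deterministic (ev-recS d e) (ev-recS d′ e′) with Eval-deterministic d d′
    ... | refl = Eval-deterministic e e′
    Eval-deterministic (ev-mu {y = y} d h) (ev-mu {y = y′} d′ h′) with <-cmp y y′
    ... | tri< y<y′ _ _ = contradiction (Eval-deterministic d (proj₂ (h′ y y<y′))) 0≢1+n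
    ... | tri≈ _ y≡y′ _ = y≡y′
    ... | tri> _ _ y′<y = contradiction (Eval-deterministic d′ (proj₂ (h y′ y′<y))) 0≢1+n
    Eval-deterministic ev-orac ev-orac = refl

    EvalV-deterministic : ∀ {n m} {gs : Vec (Code n) m} {xs ys zs} →
                          EvalV X gs xs ys → EvalV X gs xs zs → ys ≡ zs
    EvalV-deterministic evv-nil evv-nil = refl
    EvalV-deterministic (evv-cons d ds) (evv-cons d′ ds′) =
      cong₂ _∷_ (Eval-deterministic d d′) (EvalV-deterministic ds ds′)

Eventually : (ℕ → Set) → Set
Eventually P = ∃ λ s₀ → ∀ s → s₀ ≤ s → P s

Eventually-map : ∀ {P Q : ℕ → Set} → (∀ {s} → P s → Q s) → Eventually P → Eventually Q
Eventually-map f (s₀ , p) = s₀ , λ s s₀≤s → f (p s s₀≤s)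

Eventually-× : ∀ {P Q : ℕ → Set} → Eventually P → Eventually Q → Eventually (λ s → P s × Q s)
Eventually-× (s₁ , p) (s₂ , q) =
  s₁ ⊔ s₂ , λ s s₀≤s → p s (m⊔n≤o⇒m≤o s₁ s₂ s₀≤s) , q s (m⊔n≤o⇒n≤o s₁ s₂ s₀≤s)

Eventually-∀< : ∀ {P : ℕ → ℕ → Set} m → (∀ z → z < m → Eventually (P z)) →
                Eventually (λ s → ∀ z → z < m → P z s)
Eventually-∀< zero _ = 0 , λ _ _ _ ()
Eventually-∀< {P} (suc m) ev =
  Eventually-map extend (Eventually-× (Eventually-∀< m (λ z z<m → ev z (m<n⇒m<1+n z<m))) (ev m ≤-refl))
  where
    extend : ∀ {s} → (∀ z → z < m → P z s) × P m s → ∀ z → z < suc m → P z s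
    extend (below , atM) z (s≤s z≤m) with m≤n⇒m<n∨m≡n z≤m
    ... | inj₁ z<m  = below z z<m
    ... | inj₂ refl = atM

-- Stage-s approximations to Eval: the value 0 means "not yet converged", suc v means "converged to v".
-- Stages only bound the length of μ-searches, which is the only source of divergence.

ifZero : ℕ → ℕ → ℕ → ℕ
ifZero zero    a b = a
ifZero (suc _) a b = b

guarded : ∀ {m} → Vec ℕ m → ℕ → ℕ
guarded []       v = v
guarded (y ∷ ys) v = ifZero y 0 (guarded ys v)

-- The state of a μ-search after testing the arguments below k: 0 once a test has not converged,
-- 1 while every test has returned a nonzero value, and suc (suc y) once y was found.
searchStep : ℕ → ℕ → ℕ → ℕ
searchStep state r k = ifZero state 0 (ifZero (pred state) (ifZero r 0 (ifZero (pred r) (suc (suc k)) 1)) state)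

searchStep≡1 : ∀ state r k → searchStep state r k ≡ 1 → state ≡ 1 × ∃ λ w → r ≡ suc (suc w)
searchStep≡1 (suc zero) (suc (suc w)) k _ = refl , w , refl

searchStep≡2+ : ∀ state r k {y} → searchStep state r k ≡ suc (suc y) →
                state ≡ suc (suc y) ⊎ (state ≡ 1 × r ≡ 1 × y ≡ k)
searchStep≡2+ (suc zero)    (suc zero) k refl = inj₂ (refl , refl , refl)
searchStep≡2+ (suc (suc _))    r          k eq   = inj₁ eq

map-pred∘suc : ∀ {m} (ys : Vec ℕ m) → map pred (map suc ys) ≡ ys
map-pred∘suc ys = trans (sym (map-∘ pred suc ys)) (map-id ys)

guarded-suc : ∀ {m} (ys : Vec ℕ m) w → guarded (map suc ys) w ≡ w
guarded-suc []       w = refl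
guarded-suc (y ∷ ys) w = guarded-suc ys w

guarded≡suc : ∀ {m} (ys : Vec ℕ m) w {v} → guarded ys w ≡ suc v →
              ∃ λ ys′ → ys ≡ map suc ys′ × w ≡ suc v
guarded≡suc []           w eq = [] , refl , eq
guarded≡suc (suc y ∷ ys) w eq with guarded≡suc ys w eq
... | ys′ , refl , w≡ = y ∷ ys′ , refl , w≡

pred≡suc⇒≡2+ : ∀ {n m} → pred n ≡ suc m → n ≡ suc (suc m)
pred≡suc⇒≡2+ {suc (suc _)} refl = refl

module Stage (X : Oracle) where
  mutual
    approx : ∀ {n} → Code n → ℕ → Vec ℕ n → ℕ
    approx czero        s xs       = 1
    approx csucc        s (x ∷ []) = suc (suc x)
    approx (cproj i)    s xs       = suc (lookup xs i)
    approx (ccomp f gs) s xs       = guarded (approx* gs s xs) (approx f s (map pred (approx* gs s xs)))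
    approx (crec f g)   s (k ∷ xs) = approxRec f g s k xs
    approx (cmu f)      s xs       = pred (approxSearch f s s xs)
    approx corac        s (x ∷ []) = suc (if X x then 1 else 0)

    approx* : ∀ {n m} → Vec (Code n) m → ℕ → Vec ℕ n → Vec ℕ m
    approx* []       s xs = []
    approx* (g ∷ gs) s xs = approx g s xs ∷ approx* gs s xs

    approxRec : ∀ {n} → Code n → Code (suc (suc n)) → ℕ → ℕ → Vec ℕ n → ℕ
    approxRec f g s zero    xs = approx f s xs
    approxRec f g s (suc k) xs =
      ifZero (approxRec f g s k xs) 0 (approx g s (k ∷ pred (approxRec f g s k xs) ∷ xs))

    approxSearch : ∀ {n} → Code (suc n) → ℕ → ℕ → Vec ℕ n → ℕ
    approxSearch f s zero    xs = 1
    approxSearch f s (suc k) xs = searchStep (approxSearch f s k xs) (approx f s (k ∷ xs)) k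

  mutual
    approx-sound : ∀ {n} (f : Code n) s xs v → approx f s xs ≡ suc v → Eval X f xs v
    approx-sound czero        s xs       .0              refl = ev-zero
    approx-sound csucc        s (x ∷ []) .(suc x)        refl = ev-succ
    approx-sound (cproj i)    s xs       .(lookup xs i)  refl = ev-proj
    approx-sound corac        s (x ∷ []) _               refl = ev-orac
    approx-sound (ccomp f gs) s xs v eq with approx* gs s xs in gs≡
    ... | zs with guarded≡suc zs _ eq
    ... | ys , refl , f≡ = ev-comp (approx*-sound gs s xs ys gs≡)
      (approx-sound f s ys v (subst (λ zs → approx f s zs ≡ suc v) (map-pred∘suc ys) f≡))
    approx-sound (crec f g)   s (k ∷ xs) v eq = approxRec-sound f g s xs k v eq
    approx-sound (cmu f)      s xs y eq =
      let found , below = approxSearch≡2+⇒found f s xs s y (pred≡suc⇒≡2+ eq) in ev-mu found below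

    approx*-sound : ∀ {n m} (gs : Vec (Code n) m) s xs ys → approx* gs s xs ≡ map suc ys → EvalV X gs xs ys
    approx*-sound []       s xs []       _  = evv-nil
    approx*-sound (g ∷ gs) s xs (y ∷ ys) eq =
      evv-cons (approx-sound g s xs y (∷-injectiveˡ eq)) (approx*-sound gs s xs ys (∷-injectiveʳ eq))

    approxRec-sound : ∀ {n} (f : Code n) g s xs k v → approxRec f g s k xs ≡ suc v →
                      Eval X (crec f g) (k ∷ xs) v
    approxRec-sound f g s xs zero    v eq = ev-rec0 (approx-sound f s xs v eq)
    approxRec-sound f g s xs (suc k) v eq with approxRec f g s k xs in eqₖ
    ... | zero  = contradiction eq 0≢1+n
    ... | suc r = ev-recS (approxRec-sound f g s xs k r eqₖ) (approx-sound g s _ v eq)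

    approxSearch≡1⇒below : ∀ {n} (f : Code (suc n)) s xs k → approxSearch f s k xs ≡ 1 →
                           ∀ z → z < k → ∃ λ w → Eval X f (z ∷ xs) (suc w)
    approxSearch≡1⇒below f s xs (suc k) eq z (s≤s z≤k)
      with searchStep≡1 (approxSearch f s k xs) (approx f s (k ∷ xs)) k eq | m≤n⇒m<n∨m≡n z≤k
    ... | eqₖ , _     , _  | inj₁ z<k  = approxSearch≡1⇒below f s xs k eqₖ z z<k
    ... | _   , w , r≡2+w  | inj₂ refl = w , approx-sound f s (z ∷ xs) (suc w) r≡2+w

    approxSearch≡2+⇒found : ∀ {n} (f : Code (suc n)) s xs k y → approxSearch f s k xs ≡ suc (suc y) →
                            Eval X f (y ∷ xs) 0 × (∀ z → z < y → ∃ λ w → Eval X f (z ∷ xs) (suc w))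
    approxSearch≡2+⇒found f s xs (suc k) y eq
      with searchStep≡2+ (approxSearch f s k xs) (approx f s (k ∷ xs)) k eq
    ... | inj₁ eqₖ                  = approxSearch≡2+⇒found f s xs k y eqₖ
    ... | inj₂ (eqₖ , r≡1 , refl) = approx-sound f s (y ∷ xs) 0 r≡1 , approxSearch≡1⇒below f s xs y eqₖ

  below⇒approxSearch≡1 : ∀ {n} (f : Code (suc n)) s xs k →
                         (∀ z → z < k → ∃ λ w → approx f s (z ∷ xs) ≡ suc (suc w)) →
                         approxSearch f s k xs ≡ 1
  below⇒approxSearch≡1 f s xs zero    _     = refl
  below⇒approxSearch≡1 f s xs (suc k) below
    rewrite below⇒approxSearch≡1 f s xs k (λ z z<k → below z (m<n⇒m<1+n z<k))
          | proj₂ (below k ≤-refl) = refl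

  approxSearch-stable : ∀ {n} (f : Code (suc n)) s xs {y k} → approxSearch f s (suc y) xs ≡ suc (suc y) →
                        suc y ≤′ k → approxSearch f s k xs ≡ suc (suc y)
  approxSearch-stable f s xs found ≤′-refl = found
  approxSearch-stable f s xs found (≤′-step y<k) rewrite approxSearch-stable f s xs found y<k = refl

  mutual
    approx-complete : ∀ {n} {f : Code n} {xs v} → Eval X f xs v → Eventually (λ s → approx f s xs ≡ suc v)
    approx-complete ev-zero = 0 , λ _ _ → refl
    approx-complete ev-succ = 0 , λ _ _ → refl
    approx-complete ev-proj = 0 , λ _ _ → refl
    approx-complete ev-orac = 0 , λ _ _ → refl
    approx-complete {f = ccomp f gs} {xs} {v} (ev-comp {ys = ys} ds d) =
      Eventually-map combine (Eventually-× (approx*-complete ds) (approx-complete d))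
      where
        combine : ∀ {s} → approx* gs s xs ≡ map suc ys × approx f s ys ≡ suc v →
                  approx (ccomp f gs) s xs ≡ suc v
        combine {s} (gs≡ , f≡) rewrite gs≡ | map-pred∘suc ys | f≡ = guarded-suc ys (suc v)
    approx-complete (ev-rec0 d) = approx-complete d
    approx-complete {f = crec f g} {suc k ∷ xs} {v} (ev-recS {r = r} d e) =
      Eventually-map combine (Eventually-× (approx-complete d) (approx-complete e))
      where
        combine : ∀ {s} → approxRec f g s k xs ≡ suc r × approx g s (k ∷ r ∷ xs) ≡ suc v →
                  approxRec f g s (suc k) xs ≡ suc v
        combine (rec≡ , g≡) rewrite rec≡ = g≡
    approx-complete {f = cmu f} {xs} {y} (ev-mu d h) =
      Eventually-map settle
        (Eventually-× (approx-complete d) (Eventually-× (approx-complete-below h) (suc y , λ _ y<s → y<s)))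
      where
        settle : ∀ {s} → approx f s (y ∷ xs) ≡ 1 ×
                         (∀ z → z < y → ∃ λ w → approx f s (z ∷ xs) ≡ suc (suc w)) × y < s →
                 pred (approxSearch f s s xs) ≡ suc y
        settle {s} (f≡ , below , y<s) = cong pred (approxSearch-stable f s xs found (≤⇒≤′ y<s))
          where
            found : approxSearch f s (suc y) xs ≡ suc (suc y)
            found rewrite below⇒approxSearch≡1 f s xs y below | f≡ = refl

    approx*-complete : ∀ {n m} {gs : Vec (Code n) m} {xs ys} → EvalV X gs xs ys →
                       Eventually (λ s → approx* gs s xs ≡ map suc ys)
    approx*-complete evv-nil = 0 , λ _ _ → refl
    approx*-complete (evv-cons d ds) =
      Eventually-map (λ (g≡ , gs≡) → cong₂ _∷_ g≡ gs≡)
                     (Eventually-× (approx-complete d) (approx*-complete ds))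

    approx-complete-below : ∀ {n} {f : Code (suc n)} {xs y} →
                            (∀ z → z < y → ∃ λ w → Eval X f (z ∷ xs) (suc w)) →
                            Eventually (λ s → ∀ z → z < y → ∃ λ w → approx f s (z ∷ xs) ≡ suc (suc w))
    approx-complete-below {y = y} h = Eventually-∀< y λ z z<y → converges (h z z<y)
      where
        converges : ∀ {f xs z} → (∃ λ w → Eval X f (z ∷ xs) (suc w)) →
                    Eventually λ s → ∃ λ w → approx f s (z ∷ xs) ≡ suc (suc w)
        converges (w , d) = Eventually-map (w ,_) (approx-complete d)

π₀ : ∀ {n} → Code (suc n)
π₀ = cproj fzero

π₁ : ∀ {n} → Code (suc (suc n))
π₁ = cproj (fsuc fzero)

π₂ : ∀ {n} → Code (suc (suc (suc n)))
π₂ = cproj (fsuc (fsuc fzero))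

cdrop : ∀ k {n} → Vec (Code (k + n)) n
cdrop k = tabulate (λ i → cproj (k ↑ʳ i))

csuc : ∀ {n} → Code n → Code n
csuc p = ccomp csucc (p ∷ [])

cone : ∀ {n} → Code n
cone = csuc czero

cpred₁ : Code 1
cpred₁ = crec czero π₀

cpred : ∀ {n} → Code n → Code n
cpred p = ccomp cpred₁ (p ∷ [])

cifZero₃ : Code 3
cifZero₃ = crec π₀ (cproj (fsuc (fsuc (fsuc fzero))))

cifZero : ∀ {n} → Code n → Code n → Code n → Code n
cifZero p a b = ccomp cifZero₃ (p ∷ a ∷ b ∷ [])

cpred* : ∀ {n m} → Vec (Code n) m → Vec (Code n) m
cpred* []       = []
cpred* (g ∷ gs) = cpred g ∷ cpred* gs

cguarded : ∀ {n m} → Vec (Code n) m → Code n → Code n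
cguarded []       v = v
cguarded (g ∷ gs) v = cifZero g czero (cguarded gs v)

mutual
  clock : ∀ {n} → Code n → Code (suc n)
  clock czero        = cone
  clock csucc        = csuc (csuc π₁)
  clock (cproj i)    = csuc (cproj (fsuc i))
  clock (ccomp f gs) = cguarded (clock* gs) (ccomp (clock f) (π₀ ∷ cpred* (clock* gs)))
  clock (crec f g)   = ccomp (crec (clock f) (clockRecStep g)) (π₁ ∷ π₀ ∷ cdrop 2)
  clock (cmu f)      = cpred (ccomp (crec cone (clockSearchStep f)) (π₀ ∷ π₀ ∷ cdrop 1))
  clock corac        = csuc (ccomp corac (π₁ ∷ []))

  clock* : ∀ {n m} → Vec (Code n) m → Vec (Code (suc n)) m
  clock* []       = []
  clock* (g ∷ gs) = clock g ∷ clock* gs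

  -- arguments (k , approxRec f g s k xs , s , xs)
  clockRecStep : ∀ {n} → Code (suc (suc n)) → Code (suc (suc (suc n)))
  clockRecStep g = cifZero π₁ czero (ccomp (clock g) (π₂ ∷ π₀ ∷ cpred π₁ ∷ cdrop 3))

  -- arguments (k , approxSearch f s k xs , s , xs)
  clockSearchStep : ∀ {n} → Code (suc n) → Code (suc (suc (suc n)))
  clockSearchStep {n} f =
    cifZero π₁ czero (cifZero (cpred π₁) (cifZero test czero (cifZero (cpred test) (csuc (csuc π₀)) cone)) π₁)
    where
      test : Code (suc (suc (suc n)))
      test = ccomp (clock f) (π₂ ∷ π₀ ∷ cdrop 3)

module _ {X : Oracle} where
  open Stage X

  eval-csuc : ∀ {n} {p : Code n} {xs u} → Eval X p xs u → Eval X (csuc p) xs (suc u)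
  eval-csuc d = ev-comp (evv-cons d evv-nil) ev-succ

  eval-cone : ∀ {n} {xs : Vec ℕ n} → Eval X cone xs 1
  eval-cone = eval-csuc ev-zero

  eval-cpred₁ : ∀ u → Eval X cpred₁ (u ∷ []) (pred u)
  eval-cpred₁ zero    = ev-rec0 ev-zero
  eval-cpred₁ (suc u) = ev-recS (eval-cpred₁ u) ev-proj

  eval-cpred : ∀ {n} {p : Code n} {xs u} → Eval X p xs u → Eval X (cpred p) xs (pred u)
  eval-cpred d = ev-comp (evv-cons d evv-nil) (eval-cpred₁ _)

  eval-cifZero₃ : ∀ u a b → Eval X cifZero₃ (u ∷ a ∷ b ∷ []) (ifZero u a b)
  eval-cifZero₃ zero    a b = ev-rec0 ev-proj
  eval-cifZero₃ (suc u) a b = ev-recS (eval-cifZero₃ u a b) ev-proj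

  eval-cifZero : ∀ {n} {p a b : Code n} {xs u va vb} → Eval X p xs u → Eval X a xs va → Eval X b xs vb →
                 Eval X (cifZero p a b) xs (ifZero u va vb)
  eval-cifZero dp da db = ev-comp (evv-cons dp (evv-cons da (evv-cons db evv-nil))) (eval-cifZero₃ _ _ _)

  eval-cpred* : ∀ {n m} {gs : Vec (Code n) m} {xs ys} → EvalV X gs xs ys → EvalV X (cpred* gs) xs (map pred ys)
  eval-cpred* evv-nil         = evv-nil
  eval-cpred* (evv-cons d ds) = evv-cons (eval-cpred d) (eval-cpred* ds)

  eval-cguarded : ∀ {n m} {gs : Vec (Code n) m} {v : Code n} {xs ys w} →
                  EvalV X gs xs ys → Eval X v xs w → Eval X (cguarded gs v) xs (guarded ys w)
  eval-cguarded evv-nil         dv = dv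
  eval-cguarded (evv-cons d ds) dv = eval-cifZero d ev-zero (eval-cguarded ds dv)

  eval-cdrop : ∀ {k n} (ws : Vec ℕ k) (xs : Vec ℕ n) → EvalV X (cdrop k) (ws ++ xs) xs
  eval-cdrop {k} ws xs =
    subst (EvalV X (cdrop k) (ws ++ xs))
          (trans (tabulate-cong (lookup-++ʳ ws xs)) (tabulate∘lookup xs))
          (projections (k ↑ʳ_))
    where
      projections : ∀ {m} (is : Fin m → Fin (k + _)) →
                    EvalV X (tabulate (λ i → cproj (is i))) (ws ++ xs) (tabulate (λ i → lookup (ws ++ xs) (is i)))
      projections {zero}  is = evv-nil
      projections {suc m} is = evv-cons ev-proj (projections (λ i → is (fsuc i)))

  mutual
    eval-clock : ∀ {n} (f : Code n) s xs → Eval X (clock f) (s ∷ xs) (approx f s xs)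
    eval-clock czero        s xs       = eval-cone
    eval-clock csucc        s (x ∷ []) = eval-csuc (eval-csuc ev-proj)
    eval-clock (cproj i)    s xs       = eval-csuc ev-proj
    eval-clock (ccomp f gs) s xs       =
      eval-cguarded (eval-clock* gs s xs)
                    (ev-comp (evv-cons ev-proj (eval-cpred* (eval-clock* gs s xs))) (eval-clock f s _))
    eval-clock (crec f g)   s (k ∷ xs) =
      ev-comp (evv-cons ev-proj (evv-cons ev-proj (eval-cdrop (s ∷ k ∷ []) xs))) (eval-clockRec f g s xs k)
    eval-clock (cmu f)      s xs       =
      eval-cpred (ev-comp (evv-cons ev-proj (evv-cons ev-proj (eval-cdrop (s ∷ []) xs))) (eval-clockSearch f s xs s))
    eval-clock corac        s (x ∷ []) = eval-csuc (ev-comp (evv-cons ev-proj evv-nil) ev-orac)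

    eval-clock* : ∀ {n m} (gs : Vec (Code n) m) s xs → EvalV X (clock* gs) (s ∷ xs) (approx* gs s xs)
    eval-clock* []       s xs = evv-nil
    eval-clock* (g ∷ gs) s xs = evv-cons (eval-clock g s xs) (eval-clock* gs s xs)

    eval-clockRec : ∀ {n} (f : Code n) g s xs k →
                    Eval X (crec (clock f) (clockRecStep g)) (k ∷ s ∷ xs) (approxRec f g s k xs)
    eval-clockRec f g s xs zero    = ev-rec0 (eval-clock f s xs)
    eval-clockRec f g s xs (suc k) = ev-recS (eval-clockRec f g s xs k)
      (eval-cifZero ev-proj ev-zero
        (ev-comp (evv-cons ev-proj (evv-cons ev-proj
                   (evv-cons (eval-cpred ev-proj) (eval-cdrop (k ∷ _ ∷ s ∷ []) xs))))
                 (eval-clock g s _)))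

    eval-clockSearch : ∀ {n} (f : Code (suc n)) s xs k →
                       Eval X (crec cone (clockSearchStep f)) (k ∷ s ∷ xs) (approxSearch f s k xs)
    eval-clockSearch f s xs zero    = ev-rec0 eval-cone
    eval-clockSearch f s xs (suc k) = ev-recS (eval-clockSearch f s xs k)
      (eval-cifZero ev-proj ev-zero
        (eval-cifZero (eval-cpred ev-proj)
          (eval-cifZero test ev-zero (eval-cifZero (eval-cpred test) (eval-csuc (eval-csuc ev-proj)) eval-cone))
          ev-proj))
      where
        test : Eval X (ccomp (clock f) (π₂ ∷ π₀ ∷ cdrop 3)) (k ∷ approxSearch f s k xs ∷ s ∷ xs) (approx f s (k ∷ xs))
        test = ev-comp (evv-cons ev-proj (evv-cons ev-proj (eval-cdrop (k ∷ approxSearch f s k xs ∷ s ∷ []) xs)))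
                       (eval-clock f s (k ∷ xs))

  clock-sound : ∀ {n} {f : Code n} {s xs v} → Eval X (clock f) (s ∷ xs) (suc v) → Eval X f xs v
  clock-sound {f = f} {s} {xs} {v} d = approx-sound f s xs v (Eval-deterministic (eval-clock f s xs) d)

  clock-complete : ∀ {n} {f : Code n} {xs v} → Eval X f xs v →
                   Eventually (λ s → Eval X (clock f) (s ∷ xs) (suc v))
  clock-complete {f = f} {xs} d =
    Eventually-map (λ {s} eq → subst (Eval X (clock f) (s ∷ xs)) eq (eval-clock f s xs)) (approx-complete d)

2^-suc : ∀ n → 2 ^ suc n ≡ 2 ^ n + 2 ^ n
2^-suc n = cong (2 ^ n +_) (+-identityʳ (2 ^ n))

cadd : Code 2
cadd = crec π₀ (csuc π₁)

cmonus : Code 2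
cmonus = crec π₀ (cpred π₁)

cpow2 : Code 1
cpow2 = crec cone (ccomp cadd (π₁ ∷ π₁ ∷ []))

-- Vanishes exactly when y = 2 ^ n, so its μ-search inverts n ↦ 2 ^ n.
cpow2Distance : Code 2
cpow2Distance = ccomp cadd (ccomp cmonus (π₁ ∷ pow ∷ []) ∷ ccomp cmonus (pow ∷ π₁ ∷ []) ∷ [])
  where
    pow : Code 2
    pow = ccomp cpow2 (π₀ ∷ [])

clog2 : Code 1
clog2 = cmu cpow2Distance

m∸n+n∸m≡0⇒m≡n : ∀ {m n} → (m ∸ n) + (n ∸ m) ≡ 0 → m ≡ n
m∸n+n∸m≡0⇒m≡n {m} {n} eq =
  ≤-antisym (m∸n≡0⇒m≤n (m+n≡0⇒m≡0 (m ∸ n) eq)) (m∸n≡0⇒m≤n (m+n≡0⇒n≡0 (m ∸ n) eq))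

m≢n⇒m∸n+n∸m≡suc : ∀ {m n} → m ≢ n → ∃ λ w → (m ∸ n) + (n ∸ m) ≡ suc w
m≢n⇒m∸n+n∸m≡suc {m} {n} m≢n with (m ∸ n) + (n ∸ m) in eq
... | zero  = contradiction (m∸n+n∸m≡0⇒m≡n eq) m≢n
... | suc w = w , refl

module _ {X : Oracle} where
  eval-cadd : ∀ k x → Eval X cadd (k ∷ x ∷ []) (k + x)
  eval-cadd zero    x = ev-rec0 ev-proj
  eval-cadd (suc k) x = ev-recS (eval-cadd k x) (eval-csuc ev-proj)

  eval-cmonus : ∀ k x → Eval X cmonus (k ∷ x ∷ []) (x ∸ k)
  eval-cmonus zero    x = ev-rec0 ev-proj
  eval-cmonus (suc k) x =
    subst (Eval X cmonus (suc k ∷ x ∷ [])) (pred[m∸n]≡m∸[1+n] x k)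
          (ev-recS (eval-cmonus k x) (eval-cpred ev-proj))

  eval-cpow2 : ∀ n → Eval X cpow2 (n ∷ []) (2 ^ n)
  eval-cpow2 zero    = ev-rec0 eval-cone
  eval-cpow2 (suc n) =
    subst (Eval X cpow2 (suc n ∷ [])) (sym (2^-suc n))
          (ev-recS (eval-cpow2 n) (ev-comp (evv-cons ev-proj (evv-cons ev-proj evv-nil)) (eval-cadd _ _)))

  eval-cpow2Distance : ∀ n y → Eval X cpow2Distance (n ∷ y ∷ []) ((2 ^ n ∸ y) + (y ∸ 2 ^ n))
  eval-cpow2Distance n y =
    ev-comp (evv-cons (ev-comp (evv-cons ev-proj (evv-cons pow evv-nil)) (eval-cmonus _ _))
            (evv-cons (ev-comp (evv-cons pow (evv-cons ev-proj evv-nil)) (eval-cmonus _ _)) evv-nil))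
            (eval-cadd _ _)
    where
      pow : Eval X (ccomp cpow2 (π₀ ∷ [])) (n ∷ y ∷ []) (2 ^ n)
      pow = ev-comp (evv-cons ev-proj evv-nil) (eval-cpow2 n)

  eval-clog2 : ∀ n → Eval X clog2 (2 ^ n ∷ []) n
  eval-clog2 n = ev-mu atN belowN
    where
      atN : Eval X cpow2Distance (n ∷ 2 ^ n ∷ []) 0
      atN = subst (Eval X cpow2Distance (n ∷ 2 ^ n ∷ [])) (cong (λ k → k + k) (n∸n≡0 (2 ^ n)))
                  (eval-cpow2Distance n (2 ^ n))
      belowN : ∀ z → z < n → ∃ λ w → Eval X cpow2Distance (z ∷ 2 ^ n ∷ []) (suc w)
      belowN z z<n =
        let w , eq = m≢n⇒m∸n+n∸m≡suc (<⇒≢ (^-monoʳ-< 2 (s≤s (s≤s z≤n)) z<n))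
        in w , subst (Eval X cpow2Distance (z ∷ 2 ^ n ∷ [])) eq (eval-cpow2Distance z (2 ^ n))

  clog2-inverse : ∀ {y n} → Eval X clog2 (y ∷ []) n → 2 ^ n ≡ y
  clog2-inverse {y} {n} (ev-mu d _) = m∸n+n∸m≡0⇒m≡n (Eval-deterministic (eval-cpow2Distance n y) d)

2^m*odd≡2^n⇒m≡n : ∀ m n r → 2 ^ m * suc (2 * r) ≡ 2 ^ n → m ≡ n
2^m*odd≡2^n⇒m≡n zero    zero    r eq = refl
2^m*odd≡2^n⇒m≡n zero    (suc n) r eq = contradiction (trans (sym eq) (*-identityˡ _)) (even≢odd (2 ^ n) r)
2^m*odd≡2^n⇒m≡n (suc m) zero    r eq =
  contradiction (trans (sym (*-assoc 2 (2 ^ m) _)) eq) (even≢odd (2 ^ m * suc (2 * r)) 0)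
2^m*odd≡2^n⇒m≡n (suc m) (suc n) r eq =
  cong suc (2^m*odd≡2^n⇒m≡n m n r (*-cancelˡ-≡ _ _ 2 (trans (sym (*-assoc 2 (2 ^ m) _)) eq)))

enc-∷ : ∀ m l → enc (m ∷ l) ≡ 2 ^ m * suc (2 * enc l)
enc-∷ m l = begin
  suc (2 ^ m * (2 * enc l + 1) ∸ 1)   ≡⟨ cong (λ k → suc (2 ^ m * k ∸ 1)) (+-comm (2 * enc l) 1) ⟩
  suc (2 ^ m * suc (2 * enc l) ∸ 1)   ≡⟨ m+[n∸m]≡n (*-mono-≤ (m^n>0 2 m) (s≤s z≤n)) ⟩
  2 ^ m * suc (2 * enc l)             ∎
  where open ≡-Reasoning

enc-[_] : ∀ n → enc [ n ] ≡ 2 ^ n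
enc-[ n ] = trans (enc-∷ n []) (*-identityʳ (2 ^ n))

enc≡2^⇒∈ : ∀ l {n} → enc l ≡ 2 ^ n → n ∈ l
enc≡2^⇒∈ []      {n} eq = contradiction eq (<⇒≢ (m^n>0 2 n))
enc≡2^⇒∈ (m ∷ l) {n} eq with 2^m*odd≡2^n⇒m≡n m n (enc l) (trans (sym (enc-∷ m l)) eq)
... | refl = here refl

n<2^n : ∀ n → n < 2 ^ n
n<2^n zero    = s≤s z≤n
n<2^n (suc n) = subst (suc n <_) (sym (2^-suc n)) (+-mono-≤-< (m^n>0 2 n) (n<2^n n))

viaLog2 : Code 1 → Code 1
viaLog2 e = ccomp e (clog2 ∷ [])

module _ {X : Oracle} {e : Code 1} where
  halts⇒viaLog2-halts : ∀ {n v} → Eval X e (n ∷ []) v → Eval X (viaLog2 e) (enc [ n ] ∷ []) v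
  halts⇒viaLog2-halts {n} halts = ev-comp (evv-cons log evv-nil) halts
    where
      log : Eval X clog2 (enc [ n ] ∷ []) n
      log = subst (λ y → Eval X clog2 (y ∷ []) n) (sym enc-[ n ]) (eval-clog2 n)

  viaLog2-halts⇒∈ : ∀ l {v} → Eval X (viaLog2 e) (enc l ∷ []) v →
                    ∃ λ n → n ∈ l × Eval X e (n ∷ []) v
  viaLog2-halts⇒∈ l (ev-comp (evv-cons log evv-nil) halts) = _ , enc≡2^⇒∈ l (sym (clog2-inverse log)) , halts

haltingTree : List (List ℕ)
haltingTree = [] ∷ [ 0 ] ∷ []

haltingTree-closed : ∀ {σ τ} → σ ∈ haltingTree → τ ⊑ σ → τ ∈ haltingTree
haltingTree-closed {τ = []}        _                   _          = here refl
haltingTree-closed {τ = _ ∷ _}     (here refl)         (_ , ())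
haltingTree-closed {τ = _ ∷ []}    (there (here refl)) (_ , refl) = there (here refl)
haltingTree-closed {τ = _ ∷ _ ∷ _} (there (here refl)) (_ , ())

-- K ⟨0⟩ (b̄ , a⃗) holds when e halts on log₂ (enc a⃗) by stage enc b̄; singletons are coded as enc ⟨n⟩ = 2 ^ n.
haltingRequirement : Code 1 → ℕ → Requirement
haltingRequirement e i = record
  { T      = haltingTree
  ; root   = here refl
  ; closed = haltingTree-closed
  ; K      = K
  ; Ktotal = K-total
  ; Kroot  = λ _ _ _ → 0 , eval-cone
  ; d      = λ _ _ → i
  }
  where
    K : List ℕ → Code 2
    K []      = cone
    K (_ ∷ _) = clock (viaLog2 e)

    K-total : ∀ σ → σ ∈ haltingTree → ∀ X x y → ∃ λ v → Eval X (K σ) (x ∷ y ∷ []) v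
    K-total []      _ X x y = 1 , eval-cone
    K-total (_ ∷ _) _ X x y = _ , eval-clock (viaLog2 e) x (y ∷ [])

haltingRequirement-range : ∀ e i {I : ℕ → Set} → I i → HasRange (haltingRequirement e i) I
haltingRequirement-range _ _ i∈I _ _ _ _ = i∈I

haltingRequirement-transitive : ∀ e i col → TransitiveIn (haltingRequirement e i) col
haltingRequirement-transitive _ _ _ _ _ _ _ _ _ _ _ _ d≡col = d≡col

n≤enc[n] : ∀ n → n ≤ enc [ n ]
n≤enc[n] n = subst (n ≤_) (sym enc-[ n ]) (<⇒≤ (n<2^n n))


module _ (X : Oracle) (c : Coloring) {B : ℕ → Set} (B-infinite : Infinite B) (B-ce : XCE X B) (i : ℕ) where
  private
    e : Code 1
    e = proj₁ B-ce

    R : Requirement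
    R = haltingRequirement e i

  K-holds⇒∈B : ∀ {bs} l → KHolds R X [ 0 ] bs l → ∃ λ n → n ∈ l × B n
  K-holds⇒∈B l (v , d) =
    let n , n∈l , halts = viaLog2-halts⇒∈ l (clock-sound {f = viaLog2 e} d)
    in n , n∈l , proj₂ (proj₂ B-ce n) (v , halts)

  ∈B⇒K-holds : ∀ {n} → B n → ∃ λ b → KHolds R X [ 0 ] [ b ] [ n ]
  ∈B⇒K-holds {n} Bn =
    let v , halts = proj₁ (proj₂ B-ce n) Bn
        s₀ , eventually = clock-complete {f = viaLog2 e} (halts⇒viaLog2-halts halts)
    in s₀ , v , eventually (enc [ s₀ ]) (n≤enc[n] s₀)

  A*∩B⇒pair : ∀ {n} → B n → AStar c i n → ∃ λ a → ∃ λ b → a < b × B a × B b × c a b ≡ i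
  A*∩B⇒pair {n} Bn (t , cofinal) =
    let m , t+n<m , Bm = B-infinite (t + n)
    in n , m , ≤-trans (s≤s (m≤n+m n t)) t+n<m , Bn , Bm , cofinal m (≤-trans (s≤s (m≤m+n t n)) t+n<m)

  K-holds⇒Δ : ∀ {b₀ : ℕ → ℕ} {a₀ : ℕ → List ℕ} {n b} → KHolds R X [ 0 ] [ b ] [ n ] →
              Δ R X [ 0 ] (ext R b₀ 0 b) (ext R a₀ 0 [ n ])
  K-holds⇒Δ holds zero    _       = holds
  K-holds⇒Δ holds (suc _) (s≤s ())

  satisfies⇒pair : Satisfies R X c → ∃ λ a → ∃ λ b → a < b × B a × B b × c a b ≡ i
  satisfies⇒pair (_ , here refl , inj₁ (isLeaf , _)) = ⊥-elim (isLeaf 0 (there (here refl)))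
  satisfies⇒pair (_ , here refl , inj₂ (_ , b₀ , a₀ , _ , t , noExtension)) =
    let n , t<n , Bn = B-infinite t
        b , holds    = ∈B⇒K-holds Bn
    in ⊥-elim (noExtension (b , [ n ] , t<n ∷ [] , 0 , there (here refl) ,
                            K-holds⇒Δ {b₀} {a₀} {n} {b} holds))
  satisfies⇒pair (_ , there (here refl) , inj₂ (notLeaf , _)) =
    ⊥-elim (notLeaf λ _ → λ { (here ()) ; (there (here ())) ; (there (there ())) })
  satisfies⇒pair (_ , there (here refl) , inj₁ (_ , b , a , a∈A* , holds)) =
    let n , n∈a₀ , Bn = K-holds⇒∈B {[ b 0 ]} (a 0) (holds 0 (s≤s z≤n))
    in A*∩B⇒pair Bn (All.lookup (a∈A* 0 (s≤s z≤n)) n∈a₀)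

mainTheorem7 : (I J : ℕ → Set) → (∀ n → J n → I n) → I 0 → ¬ J 0 →
    (X : Oracle) (c : Coloring) →
    ((R : Requirement) → HasRange R I → (∀ i → J i → TransitiveIn R i) → Satisfies R X c) →
    (B : ℕ → Set) → Infinite B → XCE X B →
    ∀ i → I i → ∃ λ a → ∃ λ b → a < b × B a × B b × c a b ≡ i
mainTheorem7 I J _ _ _ X c satisfiesAll B B-infinite B-ce i i∈I =
  satisfies⇒pair X c B-infinite B-ce i
    (satisfiesAll (haltingRequirement e i)
                  (haltingRequirement-range e i {I} i∈I)
                  (λ col _ → haltingRequirement-transitive e i col))
  where
    e : Code 1
    e = proj₁ B-ce
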